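{- Let $m \geq 3$ be an integer. Then $g(m,4) = 10m-9$.
   Context: For positive integers $m$ and $r$, $g(m,r)$ denotes the least positive integer $N$ such that for every map $\Delta:\{1,2,\ldots,N\}\to\{1,2,\ldots,r\}$ there exist $2m$ integers $x_1<\cdots<x_m<y_1<\cdots<y_m$ in $\{1,\ldots,N\}$ with $\Delta(x_1)=\cdots=\Delta(x_m)$, $\Delta(y_1)=\cdots=\Delta(y_m)$, and $2(x_m-x_1)\leq y_m-x_1$. -}

module Defs where

open import Data.Nat using (ℕ; zero; suc; _+_; _*_; _∸_; _≤_; _<_)
open import Data.Fin using (Fin)
open import Data.Product using (Σ; _×_; ∃)
open import Relation.Nullary using (¬_)
open import Relation.Binary.PropositionalEquality using (_≡_)

StrictlyIncreasingOn : ℕ → (ℕ → ℕ) → Set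
StrictlyIncreasingOn m s = ∀ i j → i < j → j < m → s i < s j

MonoOn : {r : ℕ} → ℕ → (ℕ → Fin r) → (ℕ → ℕ) → Set
MonoOn m Δ s = ∀ i → i < m → Δ (s i) ≡ Δ (s 0)

-- Requires m ≥ 1 (used only with m ≥ 3).
HasPattern : {r : ℕ} → ℕ → ℕ → (ℕ → Fin r) → Set
HasPattern {r} m N Δ =
  Σ (ℕ → ℕ) λ x → Σ (ℕ → ℕ) λ y →
    StrictlyIncreasingOn m x × StrictlyIncreasingOn m y ×
    (1 ≤ x 0) × (x (m ∸ 1) < y 0) × (y (m ∸ 1) ≤ N) ×
    MonoOn m Δ x × MonoOn m Δ y ×
    (2 * (x (m ∸ 1) ∸ x 0) ≤ y (m ∸ 1) ∸ x 0)

-- A colouring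
-- Δ : {1..N} → {1..r} is represented as a function ℕ → Fin r whose values
-- outside {1..N} are irrelevant (the pattern only uses points in {1..N}).
Good : ℕ → ℕ → ℕ → Set
Good m r N = (Δ : ℕ → Fin r) → HasPattern m N Δ

IsG : ℕ → ℕ → ℕ → Set
IsG m r N = 1 ≤ N × Good m r N × (∀ N′ → 1 ≤ N′ → N′ < N → ¬ Good m r N′)

-- Write m = k + 1, so that 10m − 9 = 10k + 1.
--
-- Some colour occurs k + 1 times among 1, …, 4k + 1; these occurrences x satisfy
-- 2 x_m ≤ y_m + x_1 for every later monochromatic y with y_m ≥ 8k + 1.  So we are done if some
-- colour occurs k + 1 times in 4k + 2, …, 10k + 1 and also in the tail 8k + 1, …, 10k + 1.
-- Otherwise every colour present in the tail occurs at most k times in 4k + 2, …, 10k + 1;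
-- as the tail has 2k + 1 points, exactly one colour b is absent from it, and b fills at least
-- 3k of the 4k − 1 middle points 4k + 2, …, 8k.  The first k + 1 and the last k + 1
-- occurrences of b in the middle then form the pattern.
--
-- Colour the blocks ((i − 1)k, ik] with 0 1 2 3 0 1 0 0 2 3, the last colour
-- continuing forever.  Two points of one colour at distance ≥ k lie in one of seven pairs of
-- blocks.  Going through them, x_m lies beyond 4k, so y either ends by 8k, which contradicts
-- 2 x_m ≤ y_m + x_1, or starts by 4k, which contradicts x_m < y_1.

module Submission where

open import Data.Bool.Base using (T)
open import Data.Empty using (⊥; ⊥-elim)
open import Data.Fin using (Fin)
open import Data.Fin.Patterns using (0F; 1F; 2F; 3F)
open import Data.Fin.Properties using (any?) renaming (_≟_ to _≟ᶠ_)
open import Data.List.Base using (_∷_; [])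
open import Data.Nat hiding (_≟_)
open import Data.Nat.Properties
open import Data.Nat.Tactic.RingSolver using (solve-∀; solve)
open import Data.Product using (∃; _×_; _,_; proj₁; proj₂)
open import Data.Sum using (_⊎_; inj₁; inj₂; [_,_]′)
open import Relation.Binary.PropositionalEquality
open import Relation.Nullary using (Dec; yes; no; ¬_)
open import Relation.Nullary.Decidable using (_×-dec_)
open import Relation.Nullary.Negation using (¬∃⟶∀¬)
open import Relation.Unary using (Decidable)
open import Algebra.Properties.CommutativeSemigroup +-commutativeSemigroup using (x∙yz≈y∙xz)

open import Defs

spread : ∀ {n y} → StrictlyIncreasingOn n y → ∀ {i} → i < n → y 0 + i ≤ y i
spread {y = y} inc {zero}  _   = ≤-reflexive (+-identityʳ (y 0))
spread {y = y} inc {suc i} i<n = begin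
  y 0 + suc i   ≡⟨ +-suc (y 0) i ⟩
  suc (y 0 + i) ≤⟨ s≤s (spread inc (<⇒≤ i<n)) ⟩
  suc (y i)     ≤⟨ inc i (suc i) ≤-refl i<n ⟩
  y (suc i)     ∎
  where open ≤-Reasoning

spread-over-gap : ∀ {n x a g} → StrictlyIncreasingOn n x → (∀ {i} → i < n → x i ≤ a ⊎ a + g < x i) →
                  x 0 ≤ a → ∀ {i} → i < n → a < x i → x 0 + i + g ≤ x i
spread-over-gap inc avoids x₀≤a {zero}  _   a<x₀ = ⊥-elim (<⇒≱ a<x₀ x₀≤a)
spread-over-gap {x = x} {a} {g} inc avoids x₀≤a {suc i} i+1<n a<xᵢ₊₁ with avoids (<⇒≤ i+1<n)
... | inj₂ a+g<xᵢ = begin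
  x 0 + suc i + g   ≡⟨ cong (_+ g) (+-suc (x 0) i) ⟩
  suc (x 0 + i + g) ≤⟨ s≤s (spread-over-gap inc avoids x₀≤a (<⇒≤ i+1<n) (≤-<-trans (m≤m+n a g) a+g<xᵢ)) ⟩
  suc (x i)         ≤⟨ inc i (suc i) ≤-refl i+1<n ⟩
  x (suc i)         ∎
  where open ≤-Reasoning
... | inj₁ xᵢ≤a with avoids i+1<n
...   | inj₁ xᵢ₊₁≤a   = ⊥-elim (<⇒≱ a<xᵢ₊₁ xᵢ₊₁≤a)
...   | inj₂ a+g<xᵢ₊₁ = begin
  x 0 + suc i + g   ≡⟨ cong (_+ g) (+-suc (x 0) i) ⟩
  suc (x 0 + i + g) ≤⟨ s≤s (+-monoˡ-≤ g (≤-trans (spread inc (<⇒≤ i+1<n)) xᵢ≤a)) ⟩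
  suc (a + g)       ≤⟨ a+g<xᵢ₊₁ ⟩
  x (suc i)         ∎
  where open ≤-Reasoning

snoc : ℕ → (ℕ → ℕ) → ℕ → ℕ → ℕ
snoc n y v i with i <? n
... | yes _ = y i
... | no  _ = v

snoc-< : ∀ n y v {i} → i < n → snoc n y v i ≡ y i
snoc-< n y v {i} i<n with i <? n
... | yes _   = refl
... | no  i≮n = ⊥-elim (i≮n i<n)

snoc-≡ : ∀ n y v → snoc n y v n ≡ v
snoc-≡ n y v with n <? n
... | yes n<n = ⊥-elim (<-irrefl refl n<n)
... | no  _   = refl

snoc-all : ∀ (Q : ℕ → Set) {n y v} → (∀ {i} → i < n → Q (y i)) → Q v →
           ∀ {i} → i < suc n → Q (snoc n y v i)
snoc-all Q {n} {y} {v} Qy Qv {i} i<1+n with m≤n⇒m<n∨m≡n (≤-pred i<1+n)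
... | inj₁ i<n  = subst Q (sym (snoc-< n y v i<n)) (Qy i<n)
... | inj₂ refl = subst Q (sym (snoc-≡ n y v)) Qv

snoc-increasing : ∀ {n y v} → StrictlyIncreasingOn n y → (∀ {i} → i < n → y i < v) →
                  StrictlyIncreasingOn (suc n) (snoc n y v)
snoc-increasing {n} {y} {v} inc below i j i<j j<1+n with m≤n⇒m<n∨m≡n (≤-pred j<1+n)
... | inj₁ j<n  = subst₂ _<_ (sym (snoc-< n y v (<-trans i<j j<n))) (sym (snoc-< n y v j<n)) (inc i j i<j j<n)
... | inj₂ refl = subst₂ _<_ (sym (snoc-< n y v i<j)) (sym (snoc-≡ n y v)) (below i<j)

doubling⇐ : ∀ {a b c} → a ≤ b → 2 * b ≤ c + a → 2 * (b ∸ a) ≤ c ∸ a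
doubling⇐ {a} {b} {c} a≤b 2b≤c+a with m≤n⇒∃[o]m+o≡n a≤b
... | d , refl rewrite m+n∸m≡n a d = m+n≤o⇒m≤o∸n (2 * d) (+-cancelˡ-≤ a _ _ (begin
  a + (2 * d + a) ≡⟨ solve (a ∷ d ∷ []) ⟩
  2 * (a + d)     ≤⟨ 2b≤c+a ⟩
  c + a           ≡⟨ +-comm c a ⟩
  a + c           ∎))
  where open ≤-Reasoning

doubling⇒ : ∀ {a b c} → a ≤ b → b ≤ c → 2 * (b ∸ a) ≤ c ∸ a → 2 * b ≤ c + a
doubling⇒ {a} a≤b b≤c 2[b∸a]≤c∸a with m≤n⇒∃[o]m+o≡n a≤b | m≤n⇒∃[o]m+o≡n (≤-trans a≤b b≤c)
... | d , refl | e , refl rewrite m+n∸m≡n a d | m+n∸m≡n a e = begin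
  2 * (a + d)     ≡⟨ solve (a ∷ d ∷ []) ⟩
  2 * d + (a + a) ≤⟨ +-monoˡ-≤ (a + a) 2[b∸a]≤c∸a ⟩
  e + (a + a)     ≡⟨ solve (a ∷ e ∷ []) ⟩
  a + e + a       ∎
  where open ≤-Reasoning

doubling-from-bounds : ∀ {u s x₀ xₖ yₖ} → u ≤ x₀ → xₖ ≤ u + s → u + 2 * s ≤ yₖ → 2 * xₖ ≤ yₖ + x₀
doubling-from-bounds {u} {s} {x₀} {xₖ} {yₖ} u≤x₀ xₖ≤u+s u+2s≤yₖ = begin
  2 * xₖ          ≤⟨ *-monoʳ-≤ 2 xₖ≤u+s ⟩
  2 * (u + s)     ≡⟨ solve (u ∷ s ∷ []) ⟩
  u + 2 * s + u   ≤⟨ +-mono-≤ u+2s≤yₖ u≤x₀ ⟩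
  yₖ + x₀         ∎
  where open ≤-Reasoning

doubling-shrinks : ∀ {X Z W g} → X + g ≤ Z → 2 * Z ≤ W + X → Z + g ≤ W
doubling-shrinks {X} {Z} {W} {g} X+g≤Z 2Z≤W+X = +-cancelʳ-≤ X (Z + g) W (begin
  Z + g + X     ≡⟨ solve (Z ∷ g ∷ X ∷ []) ⟩
  Z + (X + g)   ≤⟨ +-monoʳ-≤ Z X+g≤Z ⟩
  Z + Z         ≡⟨ solve (Z ∷ []) ⟩
  2 * Z         ≤⟨ 2Z≤W+X ⟩
  W + X         ∎)
  where open ≤-Reasoning

record Occurrences (P : ℕ → Set) (u l n : ℕ) (y : ℕ → ℕ) : Set where
  field
    increasing : StrictlyIncreasingOn n y
    lower      : ∀ {i} → i < n → u ≤ y i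
    upper      : ∀ {i} → i < n → y i < u + l
    holds      : ∀ {i} → i < n → P (y i)

open Occurrences public

module _ {P : ℕ → Set} where

  widen : ∀ {u l n y} → Occurrences P u l n y → Occurrences P u (suc l) n y
  widen {u} {l} occ = record
    { increasing = increasing occ
    ; lower      = lower occ
    ; upper      = λ i<n → <-≤-trans (upper occ i<n) (+-monoʳ-≤ u (n≤1+n l))
    ; holds      = holds occ
    }

  extend : ∀ {u l n y} → Occurrences P u l n y → P (u + l) →
           Occurrences P u (suc l) (suc n) (snoc n y (u + l))
  extend {u} {l} occ p = record
    { increasing = snoc-increasing (increasing occ) (upper occ)
    ; lower      = snoc-all (u ≤_) (lower occ) (m≤m+n u l)
    ; upper      = snoc-all (_< u + suc l) (upper (widen occ)) (≤-reflexive (sym (+-suc u l)))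
    ; holds      = snoc-all P (holds occ) p
    }

indicator : ∀ {a} {A : Set a} → Dec A → ℕ
indicator (yes _) = 1
indicator (no  _) = 0

indicator-≤ : ∀ {a} {A : Set a} (d : Dec A) → indicator d ≤ 1
indicator-≤ (yes _) = ≤-refl
indicator-≤ (no  _) = z≤n

module Counting {P : ℕ → Set} (P? : Decidable P) where

  count : ℕ → ℕ → ℕ
  count u zero    = 0
  count u (suc l) = indicator (P? (u + l)) + count u l

  count-≤ : ∀ u l → count u l ≤ l
  count-≤ u zero = z≤n
  count-≤ u (suc l) with P? (u + l)
  ... | yes _ = s≤s (count-≤ u l)
  ... | no  _ = m≤n⇒m≤1+n (count-≤ u l)

  count-+ : ∀ u l₁ l₂ → count u (l₁ + l₂) ≡ count u l₁ + count (u + l₁) l₂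
  count-+ u l₁ zero rewrite +-identityʳ l₁ = sym (+-identityʳ (count u l₁))
  count-+ u l₁ (suc l₂) rewrite +-suc l₁ l₂ | +-assoc u l₁ l₂ | count-+ u l₁ l₂ =
    x∙yz≈y∙xz (indicator (P? (u + (l₁ + l₂)))) (count u l₁) (count (u + l₁) l₂)

  count-reaches : ∀ {u n} l → n ≤ count u l → ∃ λ l′ → l′ ≤ l × count u l′ ≡ n
  count-reaches zero n≤0 = 0 , z≤n , sym (n≤0⇒n≡0 n≤0)
  count-reaches {u} {n} (suc l) n≤c with n ≤? count u l
  ... | yes n≤c′ = let l′ , l′≤l , c≡n = count-reaches l n≤c′ in l′ , m≤n⇒m≤1+n l′≤l , c≡n
  ... | no  n≰c′ =
    suc l , ≤-refl , ≤-antisym (≤-trans (+-monoˡ-≤ _ (indicator-≤ (P? (u + l)))) (≰⇒> n≰c′)) n≤c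

  occurrences : ∀ {u} l n → n ≤ count u l → ∃ (Occurrences P u l n)
  occurrences l zero _ = (λ _ → 0) , record { increasing = λ _ _ _ (); lower = λ (); upper = λ (); holds = λ () }
  occurrences {u} (suc l) (suc n) n<c with P? (u + l)
  ... | yes p = let y , occ = occurrences l n (≤-pred n<c) in snoc n y (u + l) , extend occ p
  ... | no  _ = let y , occ = occurrences l (suc n) n<c in y , widen occ

  last-occurrences : ∀ {u} l n → suc n ≤ count u l →
    ∃ λ y → Occurrences P u l (suc n) y × (∀ {q} → y n < q → q < u + l → ¬ P q)
  last-occurrences {u} (suc l) n n<c with P? (u + l)
  ... | yes p with occurrences l n (≤-pred n<c)
  ...   | y , occ = snoc n y (u + l) , extend occ p , λ {q} y<q q< →
      ⊥-elim (<⇒≱ (subst (_< q) (snoc-≡ n y (u + l)) y<q) (≤-pred (subst (q <_) (+-suc u l) q<)))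
  last-occurrences {u} (suc l) n n<c | no ¬p with last-occurrences l n n<c
  ...   | y , occ , none-after = y , widen occ , λ {q} y<q q< →
      [ none-after y<q , (λ { refl → ¬p }) ]′ (m≤n⇒m<n∨m≡n (≤-pred (subst (q <_) (+-suc u l) q<)))

  occurrence-from : ∀ {u t} l → t ≤ l → count u t < count u l →
                    ∃ λ p → u + t ≤ p × p < u + l × P p
  occurrence-from {u} {t} l t≤l c<c with m≤n⇒∃[o]m+o≡n t≤l
  ... | s , refl with occurrences {u + t} s 1 (+-cancelˡ-< (count u t) 0 _ c<c′)
    where c<c′ = subst₂ _<_ (sym (+-identityʳ (count u t))) (count-+ u t s) c<c
  ...   | y , occ = y 0 , lower occ z<s , subst (y 0 <_) (+-assoc u t s) (upper occ z<s) , holds occ z<s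

  last-occurrences-reaching : ∀ {u t} l n → suc n ≤ count u l → t ≤ l → count u t < count u l →
    ∃ λ y → Occurrences P u l (suc n) y × u + t ≤ y n
  last-occurrences-reaching l n n<c t≤l c<c with last-occurrences l n n<c | occurrence-from l t≤l c<c
  ... | y , occ , none-after | p , t≤p , p<l , Pp = y , occ , ≤-trans t≤p (≮⇒≥ λ y<p → none-after y<p p<l Pp)

ColourClass : ∀ {r} → (ℕ → Fin r) → Fin r → ℕ → Set
ColourClass Δ c p = Δ p ≡ c

occurrences⇒pattern : ∀ {r} {Δ : ℕ → Fin r} {k N c d u l u′ l′ x y} →
  Occurrences (ColourClass Δ c) u l (suc k) x → Occurrences (ColourClass Δ d) u′ l′ (suc k) y →
  1 ≤ u → u + l ≤ u′ → u′ + l′ ≤ suc N → 2 * x k ≤ y k + x 0 → HasPattern (suc k) N Δ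
occurrences⇒pattern {Δ = Δ} {k} {x = x} {y} ox oy 1≤u u+l≤u′ u′+l′≤1+N 2xₖ≤yₖ+x₀ =
  x , y , increasing ox , increasing oy ,
  ≤-trans 1≤u (lower ox z<s) ,
  <-≤-trans (upper ox ≤-refl) (≤-trans u+l≤u′ (lower oy z<s)) ,
  ≤-pred (<-≤-trans (upper oy ≤-refl) u′+l′≤1+N) ,
  monochromatic ox , monochromatic oy ,
  doubling⇐ (≤-trans (m≤m+n (x 0) k) (spread (increasing ox) ≤-refl)) 2xₖ≤yₖ+x₀
  where
  monochromatic : ∀ {c z u l} → Occurrences (ColourClass Δ c) u l (suc k) z → MonoOn (suc k) Δ z
  monochromatic o i i<1+k = trans (holds o i<1+k) (sym (holds o z<s))

Σ₄ : (Fin 4 → ℕ) → ℕ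
Σ₄ f = f 0F + f 1F + f 2F + f 3F

Σ₄-mono-≤ : ∀ {f g} → (∀ c → f c ≤ g c) → Σ₄ f ≤ Σ₄ g
Σ₄-mono-≤ f≤g = +-mono-≤ (+-mono-≤ (+-mono-≤ (f≤g 0F) (f≤g 1F)) (f≤g 2F)) (f≤g 3F)

Σ₄-+ : ∀ f g → Σ₄ (λ c → f c + g c) ≡ Σ₄ f + Σ₄ g
Σ₄-+ f g = identity (f 0F) (f 1F) (f 2F) (f 3F) (g 0F) (g 1F) (g 2F) (g 3F)
  where
  identity : ∀ a b c d a′ b′ c′ d′ →
             a + a′ + (b + b′) + (c + c′) + (d + d′) ≡ a + b + c + d + (a′ + b′ + c′ + d′)
  identity = solve-∀

Σ₄-* : ∀ m f → Σ₄ (λ c → m * f c) ≡ m * Σ₄ f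
Σ₄-* m f = identity m (f 0F) (f 1F) (f 2F) (f 3F)
  where
  identity : ∀ m a b c d → m * a + m * b + m * c + m * d ≡ m * (a + b + c + d)
  identity = solve-∀

Σ₄-const : ∀ m → Σ₄ (λ _ → m) ≡ 4 * m
Σ₄-const m = identity m
  where
  identity : ∀ m → m + m + m + m ≡ 4 * m
  identity = solve-∀

private
  few-absent-impossible : ∀ {k S} → 1 ≤ k → suc (2 * k) + k * S ≤ 4 * k → 6 * k + S ≤ 4 * k + 2 * k * S → ⊥
  few-absent-impossible {suc j} {zero} _ _ h =
    m+1+n≰m (4 * suc j + 2 * suc j * 0) (≤-trans (≤-reflexive (identity j)) h)
    where
    identity : ∀ j → 4 * suc j + 2 * suc j * 0 + suc (suc (2 * j)) ≡ 6 * suc j + 0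
    identity = solve-∀
  few-absent-impossible {suc j} {suc zero} _ _ h =
    m+1+n≰m (4 * suc j + 2 * suc j * 1) (≤-trans (≤-reflexive (identity j)) h)
    where
    identity : ∀ j → 4 * suc j + 2 * suc j * 1 + 1 ≡ 6 * suc j + 1
    identity = solve-∀
  few-absent-impossible {suc j} {suc (suc S)} _ h _ =
    m+1+n≰m (4 * suc j) (≤-trans (≤-reflexive (identity j S)) h)
    where
    identity : ∀ j S → 4 * suc j + suc (suc j * S) ≡ suc (2 * suc j) + suc j * suc (suc S)
    identity = solve-∀

-- P c and Q c count colour c in the middle and in the tail, and s c = 1 exactly when c is
-- absent from the tail.  Summed over the colours, tail-bound says that at most one colour is
-- absent, while total-bound says, if no P c reaches 3k, that at least two are.
heavy-colour : ∀ {k} (P Q : Fin 4 → ℕ) → 1 ≤ k → Σ₄ Q ≡ suc (2 * k) → Σ₄ P + Σ₄ Q ≡ 6 * k →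
               (∀ c → Q c ≡ 0 ⊎ P c + Q c ≤ k) → ∃ λ b → 3 * k ≤ P b
heavy-colour {k} P Q 1≤k ΣQ≡1+2k ΣP+ΣQ≡6k absent⊎small with any? (λ b → 3 * k ≤? P b)
... | yes heavy = heavy
... | no  none  = ⊥-elim (few-absent-impossible 1≤k tail-sum total-sum)
  where
  open ≤-Reasoning
  s : Fin 4 → ℕ
  s c = indicator (Q c ≟ 0)

  tail-bound : ∀ c → Q c + k * s c ≤ k
  tail-bound c with Q c ≟ 0 | absent⊎small c
  ... | yes Qc≡0 | _          = ≤-reflexive (cong₂ _+_ Qc≡0 (*-identityʳ k))
  ... | no  Qc≢0 | inj₁ Qc≡0  = ⊥-elim (Qc≢0 Qc≡0)
  ... | no  _    | inj₂ small = begin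
    Q c + k * 0 ≡⟨ cong (Q c +_) (*-zeroʳ k) ⟩
    Q c + 0     ≡⟨ +-identityʳ (Q c) ⟩
    Q c         ≤⟨ m≤n+m (Q c) (P c) ⟩
    P c + Q c   ≤⟨ small ⟩
    k           ∎

  total-bound : ∀ c → P c + Q c + s c ≤ k + 2 * k * s c
  total-bound c with Q c ≟ 0 | absent⊎small c
  ... | yes Qc≡0 | _          = begin
    P c + Q c + 1 ≡⟨ cong (λ q → P c + q + 1) Qc≡0 ⟩
    P c + 0 + 1   ≡⟨ cong (_+ 1) (+-identityʳ (P c)) ⟩
    P c + 1       ≡⟨ +-comm (P c) 1 ⟩
    suc (P c)     ≤⟨ ≰⇒> (¬∃⟶∀¬ none c) ⟩
    3 * k         ≡⟨ solve (k ∷ []) ⟩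
    k + 2 * k * 1 ∎
  ... | no  Qc≢0 | inj₁ Qc≡0  = ⊥-elim (Qc≢0 Qc≡0)
  ... | no  _    | inj₂ small = begin
    P c + Q c + 0 ≡⟨ +-identityʳ _ ⟩
    P c + Q c     ≤⟨ small ⟩
    k             ≡⟨ solve (k ∷ []) ⟩
    k + 2 * k * 0 ∎

  tail-sum : suc (2 * k) + k * Σ₄ s ≤ 4 * k
  tail-sum = begin
    suc (2 * k) + k * Σ₄ s    ≡⟨ cong₂ _+_ (sym ΣQ≡1+2k) (sym (Σ₄-* k s)) ⟩
    Σ₄ Q + Σ₄ (λ c → k * s c) ≡⟨ Σ₄-+ Q (λ c → k * s c) ⟨
    Σ₄ (λ c → Q c + k * s c)  ≤⟨ Σ₄-mono-≤ tail-bound ⟩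
    Σ₄ (λ _ → k)              ≡⟨ Σ₄-const k ⟩
    4 * k                     ∎

  total-sum : 6 * k + Σ₄ s ≤ 4 * k + 2 * k * Σ₄ s
  total-sum = begin
    6 * k + Σ₄ s                           ≡⟨ cong (_+ Σ₄ s) (trans (sym ΣP+ΣQ≡6k) (sym (Σ₄-+ P Q))) ⟩
    Σ₄ (λ c → P c + Q c) + Σ₄ s            ≡⟨ Σ₄-+ (λ c → P c + Q c) s ⟨
    Σ₄ (λ c → P c + Q c + s c)             ≤⟨ Σ₄-mono-≤ total-bound ⟩
    Σ₄ (λ c → k + 2 * k * s c)             ≡⟨ Σ₄-+ (λ _ → k) (λ c → 2 * k * s c) ⟩
    Σ₄ (λ _ → k) + Σ₄ (λ c → 2 * k * s c)  ≡⟨ cong₂ _+_ (Σ₄-const k) (Σ₄-* (2 * k) s) ⟩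
    4 * k + 2 * k * Σ₄ s                   ∎

module Colours (Δ : ℕ → Fin 4) where

  module Colour (c : Fin 4) = Counting {ColourClass Δ c} (λ p → Δ p ≟ᶠ c)

  #[_] : Fin 4 → ℕ → ℕ → ℕ
  #[ c ] = Colour.count c

  #-sum : ∀ u l → Σ₄ (λ c → #[ c ] u l) ≡ l
  #-sum u zero    = refl
  #-sum u (suc l) = begin
    Σ₄ (λ c → indicator (Δ (u + l) ≟ᶠ c) + #[ c ] u l)
      ≡⟨ Σ₄-+ (λ c → indicator (Δ (u + l) ≟ᶠ c)) (λ c → #[ c ] u l) ⟩
    Σ₄ (λ c → indicator (Δ (u + l) ≟ᶠ c)) + Σ₄ (λ c → #[ c ] u l)
      ≡⟨ cong₂ _+_ (one-colour (Δ (u + l))) (#-sum u l) ⟩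
    suc l
      ∎
    where
    open ≡-Reasoning
    one-colour : ∀ a → Σ₄ (λ c → indicator (a ≟ᶠ c)) ≡ 1
    one-colour 0F = refl
    one-colour 1F = refl
    one-colour 2F = refl
    one-colour 3F = refl

  pigeonhole : ∀ u k → ∃ λ c → suc k ≤ #[ c ] u (suc (4 * k))
  pigeonhole u k with any? (λ c → suc k ≤? #[ c ] u (suc (4 * k)))
  ... | yes found = found
  ... | no  none  = ⊥-elim (<-irrefl refl (begin
    suc (4 * k)                          ≡⟨ #-sum u (suc (4 * k)) ⟨
    Σ₄ (λ c → #[ c ] u (suc (4 * k)))    ≤⟨ Σ₄-mono-≤ (λ c → ≤-pred (≰⇒> (¬∃⟶∀¬ none c))) ⟩
    Σ₄ (λ _ → k)                         ≡⟨ Σ₄-const k ⟩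
    4 * k                                ∎))
    where open ≤-Reasoning

-- Positions are split into [1, u₁), the middle [u₁, u₁ + A) and the tail [u₁ + A, N], of
-- lengths 4k + 1, 4k − 1 and 2k + 1; writing k = j + 1 keeps these lengths free of ∸.
module UpperBound (j : ℕ) (1≤j : 1 ≤ j) (Δ : ℕ → Fin 4) where

  open Colours Δ

  k = suc j
  N = 10 * k + 1
  u₁ = 1 + suc (4 * k)
  A = 3 + 4 * j
  S = suc (2 * k)

  end : u₁ + (A + S) ≡ suc N
  end = identity j
    where
    identity : ∀ j → 1 + suc (4 * suc j) + ((3 + 4 * j) + suc (2 * suc j)) ≡ suc (10 * suc j + 1)
    identity = solve-∀

  tail-reached : ∀ {d} → suc k ≤ #[ d ] u₁ (A + S) → 1 ≤ #[ d ] (u₁ + A) S → HasPattern (suc k) N Δ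
  tail-reached {d} enough present
    with pigeonhole 1 k | Colour.last-occurrences-reaching d (A + S) k enough (m≤m+n A S) beyond-middle
    where
    beyond-middle : #[ d ] u₁ A < #[ d ] u₁ (A + S)
    beyond-middle = begin-strict
      #[ d ] u₁ A                        ≡⟨ +-identityʳ _ ⟨
      #[ d ] u₁ A + 0                    <⟨ +-monoʳ-< (#[ d ] u₁ A) present ⟩
      #[ d ] u₁ A + #[ d ] (u₁ + A) S    ≡⟨ Colour.count-+ d u₁ A S ⟨
      #[ d ] u₁ (A + S)                  ∎
      where open ≤-Reasoning
  ... | c , many | y , oy , reach with Colour.occurrences c (suc (4 * k)) (suc k) many
  ... | x , ox = occurrences⇒pattern ox oy ≤-refl ≤-refl (≤-reflexive end)
    (doubling-from-bounds (lower ox z<s) (≤-pred (upper ox ≤-refl)) (≤-trans (≤-reflexive (1+8k≡u₁+A j)) reach))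
    where
    1+8k≡u₁+A : ∀ j → 1 + 2 * (4 * suc j) ≡ 1 + suc (4 * suc j) + (3 + 4 * j)
    1+8k≡u₁+A = solve-∀

  middle-arithmetic : ∀ {t R c} → 2 + t + R ≡ A → c ≤ R → 3 * k ≤ suc k + c → suc k ≤ c × t < c
  middle-arithmetic {t} {R} {c} 2+t+R≡A c≤R 3k≤1+k+c = ≤-trans 1+k≤1+2j 1+2j≤c , ≤-trans (s≤s t≤2j) 1+2j≤c
    where
    open ≤-Reasoning
    1+2j≤c : suc (2 * j) ≤ c
    1+2j≤c = +-cancelˡ-≤ (suc k) _ _ (≤-trans (≤-reflexive (identity j)) 3k≤1+k+c)
      where
      identity : ∀ j → suc (suc j) + suc (2 * j) ≡ 3 * suc j
      identity = solve-∀
    1+k≤1+2j : suc k ≤ suc (2 * j)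
    1+k≤1+2j = s≤s (≤-trans (+-monoˡ-≤ j 1≤j) (+-monoʳ-≤ j (m≤m+n j 0)))
    t≤2j : t ≤ 2 * j
    t≤2j = +-cancelʳ-≤ c t (2 * j) (begin
      t + c                 ≤⟨ +-monoʳ-≤ t c≤R ⟩
      t + R                 ≡⟨ suc-injective (suc-injective 2+t+R≡A) ⟩
      suc (4 * j)           ≡⟨ solve (j ∷ []) ⟩
      2 * j + suc (2 * j)   ≤⟨ +-monoʳ-≤ (2 * j) 1+2j≤c ⟩
      2 * j + c             ∎)

  middle-split : ∀ {b} t R → 2 + t + R ≡ A → #[ b ] u₁ (2 + t) ≡ suc k → 3 * k ≤ #[ b ] u₁ A →
                 HasPattern (suc k) N Δ
  middle-split {b} t R 2+t+R≡A #≡1+k heavy =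
    let x , ox         = Colour.occurrences b (2 + t) (suc k) (≤-reflexive (sym #≡1+k))
        enough , t<c   = middle-arithmetic 2+t+R≡A (Colour.count-≤ b B R) (≤-trans heavy (≤-reflexive split))
        y , oy , reach = Colour.last-occurrences-reaching b R k enough (≤-trans (<⇒≤ t<c) (Colour.count-≤ b B R))
                           (≤-<-trans (Colour.count-≤ b B t) t<c)
    in occurrences⇒pattern ox oy (s≤s z≤n) ≤-refl B+R≤1+N
         (doubling-from-bounds (lower ox z<s) (≤-pred (subst (x k <_) (+-suc u₁ (suc t)) (upper ox ≤-refl)))
           (≤-trans (≤-reflexive (identity u₁ t)) reach))
    where
    B = u₁ + (2 + t)
    split : #[ b ] u₁ A ≡ suc k + #[ b ] B R
    split = begin
      #[ b ] u₁ A                        ≡⟨ cong (#[ b ] u₁) 2+t+R≡A ⟨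
      #[ b ] u₁ (2 + t + R)              ≡⟨ Colour.count-+ b u₁ (2 + t) R ⟩
      #[ b ] u₁ (2 + t) + #[ b ] B R     ≡⟨ cong (_+ #[ b ] B R) #≡1+k ⟩
      suc k + #[ b ] B R                 ∎
      where open ≡-Reasoning
    identity : ∀ u t → u + 2 * suc t ≡ u + (2 + t) + t
    identity = solve-∀
    B+R≤1+N : B + R ≤ suc N
    B+R≤1+N = begin
      u₁ + (2 + t) + R   ≡⟨ +-assoc u₁ (2 + t) R ⟩
      u₁ + (2 + t + R)   ≡⟨ cong (u₁ +_) 2+t+R≡A ⟩
      u₁ + A             ≤⟨ +-monoʳ-≤ u₁ (m≤m+n A S) ⟩
      u₁ + (A + S)       ≡⟨ end ⟩
      suc N              ∎
      where open ≤-Reasoning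

  middle-heavy : ∀ {b} → 3 * k ≤ #[ b ] u₁ A → HasPattern (suc k) N Δ
  middle-heavy {b} heavy =
    let l , l≤A , #≡1+k = Colour.count-reaches b A (≤-trans 1+k≤3k heavy)
        t , 2+t≡l       = m≤n⇒∃[o]m+o≡n (≤-trans (s≤s (s≤s z≤n)) (subst (_≤ l) #≡1+k (Colour.count-≤ b u₁ l)))
        R , l+R≡A       = m≤n⇒∃[o]m+o≡n l≤A
    in middle-split t R (trans (cong (_+ R) 2+t≡l) l+R≡A) (trans (cong (#[ b ] u₁) 2+t≡l) #≡1+k) heavy
    where
    1+k≤3k : suc k ≤ 3 * k
    1+k≤3k = ≤-trans (+-monoˡ-≤ k (s≤s z≤n)) (+-monoʳ-≤ k (m≤m+n k _))

  TailRich : Fin 4 → Set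
  TailRich d = suc k ≤ #[ d ] u₁ (A + S) × 1 ≤ #[ d ] (u₁ + A) S

  heavy-middle : (∀ d → ¬ TailRich d) → ∃ λ b → 3 * k ≤ #[ b ] u₁ A
  heavy-middle poor = heavy-colour (λ d → #[ d ] u₁ A) (λ d → #[ d ] (u₁ + A) S) (s≤s z≤n)
    (#-sum (u₁ + A) S) (trans (cong₂ _+_ (#-sum u₁ A) (#-sum (u₁ + A) S)) (A+S≡6k j)) absent⊎small
    where
    A+S≡6k : ∀ j → 3 + 4 * j + suc (2 * suc j) ≡ 6 * suc j
    A+S≡6k = solve-∀
    absent⊎small : ∀ d → #[ d ] (u₁ + A) S ≡ 0 ⊎ #[ d ] u₁ A + #[ d ] (u₁ + A) S ≤ k
    absent⊎small d with #[ d ] (u₁ + A) S ≟ 0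
    ... | yes absent  = inj₁ absent
    ... | no  present = inj₂ (≤-pred (≰⇒> λ enough →
      poor d (subst (suc k ≤_) (sym (Colour.count-+ d u₁ A S)) enough , n≢0⇒n>0 present)))

  upper-bound : HasPattern (suc k) N Δ
  upper-bound with any? (λ d → (suc k ≤? #[ d ] u₁ (A + S)) ×-dec (1 ≤? #[ d ] (u₁ + A) S))
  ... | yes (d , enough , present) = tail-reached enough present
  ... | no  none                   = middle-heavy (proj₂ (heavy-middle (¬∃⟶∀¬ none)))

module LowerBound (k : ℕ) where

  data Zone (p : ℕ) : Fin 4 → Set where
    I₁   : p ≤ 1 * k → Zone p 0F
    I₂   : 1 * k < p → p ≤ 2 * k → Zone p 1F
    I₃   : 2 * k < p → p ≤ 3 * k → Zone p 2F
    I₄   : 3 * k < p → p ≤ 4 * k → Zone p 3F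
    I₅   : 4 * k < p → p ≤ 5 * k → Zone p 0F
    I₆   : 5 * k < p → p ≤ 6 * k → Zone p 1F
    I₇₈  : 6 * k < p → p ≤ 8 * k → Zone p 0F
    I₉   : 8 * k < p → p ≤ 9 * k → Zone p 2F
    I₁₀₊ : 9 * k < p → Zone p 3F

  zone : ∀ p → ∃ (Zone p)
  zone p with p ≤? 1 * k
  ... | yes h = 0F , I₁ h
  ... | no h₁ with p ≤? 2 * k
  ... | yes h = 1F , I₂ (≰⇒> h₁) h
  ... | no h₂ with p ≤? 3 * k
  ... | yes h = 2F , I₃ (≰⇒> h₂) h
  ... | no h₃ with p ≤? 4 * k
  ... | yes h = 3F , I₄ (≰⇒> h₃) h
  ... | no h₄ with p ≤? 5 * k
  ... | yes h = 0F , I₅ (≰⇒> h₄) h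
  ... | no h₅ with p ≤? 6 * k
  ... | yes h = 1F , I₆ (≰⇒> h₅) h
  ... | no h₆ with p ≤? 8 * k
  ... | yes h = 0F , I₇₈ (≰⇒> h₆) h
  ... | no h₈ with p ≤? 9 * k
  ... | yes h = 2F , I₉ (≰⇒> h₈) h
  ... | no h₉ = 3F , I₁₀₊ (≰⇒> h₉)

  colouring : ℕ → Fin 4
  colouring p = proj₁ (zone p)

  zone-of : ∀ {p c} → colouring p ≡ c → Zone p c
  zone-of {p} refl = proj₂ (zone p)

  ≤-multiple : ∀ a b → {T (a ≤ᵇ b)} → a * k ≤ b * k
  ≤-multiple a b {a≤b} = *-monoˡ-≤ k (≤ᵇ⇒≤ a b a≤b)

  next-multiple : ∀ a {p q} → a * k < p → p + k ≤ q → suc a * k < q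
  next-multiple a {p} a*k<p p+k≤q = <-≤-trans (+-monoʳ-< k a*k<p) (≤-trans (≤-reflexive (+-comm k p)) p+k≤q)

  no-room : ∀ a b → {T (b ≤ᵇ suc a)} → ∀ {p q} → a * k < p → p + k ≤ q → q ≤ b * k → ⊥
  no-room a b {b≤1+a} a*k<p p+k≤q q≤b*k =
    <⇒≱ (next-multiple a a*k<p p+k≤q) (≤-trans q≤b*k (≤-multiple b (suc a) {b≤1+a}))

  data FarPair (p q : ℕ) : Fin 4 → Set where
    I₁-I₅   : p ≤ 1 * k → 4 * k < q → FarPair p q 0F
    I₁-I₇₈  : p ≤ 1 * k → 6 * k < q → FarPair p q 0F
    I₅-I₇₈  : p ≤ 5 * k → 6 * k < q → q ≤ 8 * k → FarPair p q 0F
    I₇₈-I₇₈ : 6 * k < p → q ≤ 8 * k → FarPair p q 0F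
    I₂-I₆   : p ≤ 2 * k → 5 * k < q → FarPair p q 1F
    I₃-I₉   : p ≤ 3 * k → 8 * k < q → FarPair p q 2F
    I₄-I₁₀₊ : p ≤ 4 * k → 9 * k < q → FarPair p q 3F

  far-pair : ∀ {p q c} → Zone p c → Zone q c → 1 ≤ p → p + k ≤ q → q ≤ 10 * k → FarPair p q c
  far-pair (I₁ p≤k)     (I₁ q≤k)        1≤p far _     = ⊥-elim (no-room 0 1 1≤p far q≤k)
  far-pair (I₁ p≤k)     (I₅ 4k<q _)     _   _   _     = I₁-I₅ p≤k 4k<q
  far-pair (I₁ p≤k)     (I₇₈ 6k<q _)    _   _   _     = I₁-I₇₈ p≤k 6k<q
  far-pair (I₅ 4k<p _)  (I₁ q≤k)        _   far _     = ⊥-elim (no-room 4 1 4k<p far q≤k)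
  far-pair (I₅ 4k<p _)  (I₅ _ q≤5k)     _   far _     = ⊥-elim (no-room 4 5 4k<p far q≤5k)
  far-pair (I₅ _ p≤5k)  (I₇₈ 6k<q q≤8k) _   _   _     = I₅-I₇₈ p≤5k 6k<q q≤8k
  far-pair (I₇₈ 6k<p _) (I₁ q≤k)        _   far _     = ⊥-elim (no-room 6 1 6k<p far q≤k)
  far-pair (I₇₈ 6k<p _) (I₅ _ q≤5k)     _   far _     = ⊥-elim (no-room 6 5 6k<p far q≤5k)
  far-pair (I₇₈ 6k<p _) (I₇₈ _ q≤8k)    _   _   _     = I₇₈-I₇₈ 6k<p q≤8k
  far-pair (I₂ k<p _)   (I₂ _ q≤2k)     _   far _     = ⊥-elim (no-room 1 2 k<p far q≤2k)
  far-pair (I₂ _ p≤2k)  (I₆ 5k<q _)     _   _   _     = I₂-I₆ p≤2k 5k<q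
  far-pair (I₆ 5k<p _)  (I₂ _ q≤2k)     _   far _     = ⊥-elim (no-room 5 2 5k<p far q≤2k)
  far-pair (I₆ 5k<p _)  (I₆ _ q≤6k)     _   far _     = ⊥-elim (no-room 5 6 5k<p far q≤6k)
  far-pair (I₃ 2k<p _)  (I₃ _ q≤3k)     _   far _     = ⊥-elim (no-room 2 3 2k<p far q≤3k)
  far-pair (I₃ _ p≤3k)  (I₉ 8k<q _)     _   _   _     = I₃-I₉ p≤3k 8k<q
  far-pair (I₉ 8k<p _)  (I₃ _ q≤3k)     _   far _     = ⊥-elim (no-room 8 3 8k<p far q≤3k)
  far-pair (I₉ 8k<p _)  (I₉ _ q≤9k)     _   far _     = ⊥-elim (no-room 8 9 8k<p far q≤9k)
  far-pair (I₄ 3k<p _)  (I₄ _ q≤4k)     _   far _     = ⊥-elim (no-room 3 4 3k<p far q≤4k)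
  far-pair (I₄ _ p≤4k)  (I₁₀₊ 9k<q)     _   _   _     = I₄-I₁₀₊ p≤4k 9k<q
  far-pair (I₁₀₊ 9k<p)  (I₄ _ q≤4k)     _   far _     = ⊥-elim (no-room 9 4 9k<p far q≤4k)
  far-pair (I₁₀₊ 9k<p)  (I₁₀₊ _)        _   far q≤10k = ⊥-elim (no-room 9 10 9k<p far q≤10k)

  far-pair-late : ∀ {p q c} → FarPair p q c → p + k ≤ q → 4 * k < q
  far-pair-late (I₁-I₅ _ 4k<q)    _   = 4k<q
  far-pair-late (I₁-I₇₈ _ 6k<q)   _   = ≤-<-trans (≤-multiple 4 6) 6k<q
  far-pair-late (I₅-I₇₈ _ 6k<q _) _   = ≤-<-trans (≤-multiple 4 6) 6k<q
  far-pair-late (I₇₈-I₇₈ 6k<p _)  far = ≤-<-trans (≤-multiple 4 7) (next-multiple 6 6k<p far)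
  far-pair-late (I₂-I₆ _ 5k<q)    _   = ≤-<-trans (≤-multiple 4 5) 5k<q
  far-pair-late (I₃-I₉ _ 8k<q)    _   = ≤-<-trans (≤-multiple 4 8) 8k<q
  far-pair-late (I₄-I₁₀₊ _ 9k<q)  _   = ≤-<-trans (≤-multiple 4 9) 9k<q

  far-pair-early : ∀ {p q c} → FarPair p q c → p ≤ 4 * k ⊎ q ≤ 8 * k
  far-pair-early (I₁-I₅ p≤k _)     = inj₁ (≤-trans p≤k (≤-multiple 1 4))
  far-pair-early (I₁-I₇₈ p≤k _)    = inj₁ (≤-trans p≤k (≤-multiple 1 4))
  far-pair-early (I₅-I₇₈ _ _ q≤8k) = inj₂ q≤8k
  far-pair-early (I₇₈-I₇₈ _ q≤8k)  = inj₂ q≤8k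
  far-pair-early (I₂-I₆ p≤2k _)    = inj₁ (≤-trans p≤2k (≤-multiple 2 4))
  far-pair-early (I₃-I₉ p≤3k _)    = inj₁ (≤-trans p≤3k (≤-multiple 3 4))
  far-pair-early (I₄-I₁₀₊ p≤4k _)  = inj₁ p≤4k

  overshoots-8k : ∀ a {X Z g} → a * k < Z → X + g ≤ Z → 2 * Z ≤ 8 * k + X → 8 * k ≤ a * k + g → ⊥
  overshoots-8k a {g = g} a*k<Z X+g≤Z 2Z≤8k+X =
    <⇒≱ (≤-trans (+-monoˡ-< g a*k<Z) (doubling-shrinks X+g≤Z 2Z≤8k+X))

  twice-exceeds : ∀ a b → {T (b ≤ᵇ 2 * a)} → ∀ {Z} → a * k < Z → 2 * Z ≤ b * k → ⊥
  twice-exceeds a b {b≤2a} {Z} a*k<Z 2Z≤b*k = <⇒≱ (*-monoʳ-< 2 a*k<Z) (begin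
    2 * Z         ≤⟨ 2Z≤b*k ⟩
    b * k         ≤⟨ ≤-multiple b (2 * a) {b≤2a} ⟩
    2 * a * k     ≡⟨ *-assoc 2 a k ⟩
    2 * (a * k)   ∎)
    where open ≤-Reasoning

  no-doubling-below-8k : ∀ {x c} → StrictlyIncreasingOn (suc k) x → (∀ {i} → i < suc k → Zone (x i) c) →
                         FarPair (x 0) (x k) c → 2 * x k ≤ 8 * k + x 0 → ⊥
  no-doubling-below-8k {x} inc zones (I₁-I₅ x₀≤k 4k<xₖ) 2xₖ≤8k+x₀ =
    overshoots-8k 4 4k<xₖ (subst (_≤ x k) (+-assoc (x 0) k (3 * k)) span) 2xₖ≤8k+x₀
      (≤-reflexive (solve (k ∷ [])))
    where
    avoids : ∀ {i} → i < suc k → x i ≤ 1 * k ⊎ 1 * k + 3 * k < x i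
    avoids {i} i< with zones i<
    ... | I₁ xᵢ≤k     = inj₁ xᵢ≤k
    ... | I₅ 4k<xᵢ _  = inj₂ (subst (_< x i) (*-distribʳ-+ k 1 3) 4k<xᵢ)
    ... | I₇₈ 6k<xᵢ _ = inj₂ (subst (_< x i) (*-distribʳ-+ k 1 3) (≤-<-trans (≤-multiple 4 6) 6k<xᵢ))
    span : x 0 + k + 3 * k ≤ x k
    span = spread-over-gap inc avoids x₀≤k ≤-refl (≤-<-trans (≤-multiple 1 4) 4k<xₖ)
  no-doubling-below-8k {x} inc zones (I₅-I₇₈ x₀≤5k 6k<xₖ _) 2xₖ≤8k+x₀ =
    overshoots-8k 6 6k<xₖ (subst (_≤ x k) (+-assoc (x 0) k k) span) 2xₖ≤8k+x₀
      (≤-reflexive (solve (k ∷ [])))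
    where
    avoids : ∀ {i} → i < suc k → x i ≤ 5 * k ⊎ 5 * k + k < x i
    avoids {i} i< with zones i<
    ... | I₁ xᵢ≤k     = inj₁ (≤-trans xᵢ≤k (≤-multiple 1 5))
    ... | I₅ _ xᵢ≤5k  = inj₁ xᵢ≤5k
    ... | I₇₈ 6k<xᵢ _ = inj₂ (subst (_< x i) (+-comm k (5 * k)) 6k<xᵢ)
    span : x 0 + k + k ≤ x k
    span = spread-over-gap inc avoids x₀≤5k ≤-refl (≤-<-trans (≤-multiple 5 6) 6k<xₖ)
  no-doubling-below-8k _ _ (I₁-I₇₈ x₀≤k 6k<xₖ) 2xₖ≤8k+x₀ =
    twice-exceeds 6 9 6k<xₖ
      (≤-trans 2xₖ≤8k+x₀ (≤-trans (+-monoʳ-≤ (8 * k) x₀≤k) (≤-reflexive (sym (*-distribʳ-+ k 8 1)))))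
  no-doubling-below-8k inc _ (I₇₈-I₇₈ 6k<x₀ _) 2xₖ≤8k+x₀ =
    overshoots-8k 7 (next-multiple 6 6k<x₀ (spread inc ≤-refl)) (spread inc ≤-refl) 2xₖ≤8k+x₀
      (≤-reflexive (solve (k ∷ [])))
  no-doubling-below-8k _ _ (I₂-I₆ x₀≤2k 5k<xₖ) 2xₖ≤8k+x₀ =
    twice-exceeds 5 10 5k<xₖ
      (≤-trans 2xₖ≤8k+x₀ (≤-trans (+-monoʳ-≤ (8 * k) x₀≤2k) (≤-reflexive (sym (*-distribʳ-+ k 8 2)))))
  no-doubling-below-8k inc _ (I₃-I₉ _ 8k<xₖ) 2xₖ≤8k+x₀ =
    overshoots-8k 8 8k<xₖ (spread inc ≤-refl) 2xₖ≤8k+x₀ (m≤m+n (8 * k) k)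
  no-doubling-below-8k inc _ (I₄-I₁₀₊ _ 9k<xₖ) 2xₖ≤8k+x₀ =
    overshoots-8k 9 9k<xₖ (spread inc ≤-refl) 2xₖ≤8k+x₀ (≤-trans (≤-multiple 8 9) (m≤m+n (9 * k) k))

  no-pattern : ∀ {N} → N ≤ 10 * k → ¬ HasPattern (suc k) N colouring
  no-pattern N≤10k (x , y , incx , incy , 1≤x₀ , xₖ<y₀ , yₖ≤N , monox , monoy , condition) =
    [ y₀-not-early , yₖ-not-early ]′ (far-pair-early yPair)
    where
    open ≤-Reasoning
    x₀+k≤xₖ = spread incx ≤-refl
    y₀+k≤yₖ = spread incy ≤-refl
    xₖ≤yₖ : x k ≤ y k
    xₖ≤yₖ = ≤-trans (<⇒≤ xₖ<y₀) (≤-trans (m≤m+n (y 0) k) y₀+k≤yₖ)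
    yₖ≤10k : y k ≤ 10 * k
    yₖ≤10k = ≤-trans yₖ≤N N≤10k
    xPair : FarPair (x 0) (x k) (colouring (x 0))
    xPair = far-pair (zone-of refl) (zone-of (monox k ≤-refl)) 1≤x₀ x₀+k≤xₖ (≤-trans xₖ≤yₖ yₖ≤10k)
    yPair : FarPair (y 0) (y k) (colouring (y 0))
    yPair = far-pair (zone-of refl) (zone-of (monoy k ≤-refl))
              (≤-trans 1≤x₀ (≤-trans (m≤m+n (x 0) k) (≤-trans x₀+k≤xₖ (<⇒≤ xₖ<y₀)))) y₀+k≤yₖ yₖ≤10k
    y₀-not-early : y 0 ≤ 4 * k → ⊥
    y₀-not-early y₀≤4k = <⇒≱ (<-trans (far-pair-late xPair x₀+k≤xₖ) xₖ<y₀) y₀≤4k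
    yₖ-not-early : y k ≤ 8 * k → ⊥
    yₖ-not-early yₖ≤8k = no-doubling-below-8k incx (λ i< → zone-of (monox _ i<)) xPair (begin
      2 * x k      ≤⟨ doubling⇒ (≤-trans (m≤m+n (x 0) k) x₀+k≤xₖ) xₖ≤yₖ condition ⟩
      y k + x 0    ≤⟨ +-monoˡ-≤ (x 0) yₖ≤8k ⟩
      8 * k + x 0  ∎)

good-10k+1 : ∀ {k} → 2 ≤ k → Good (suc k) 4 (10 * k + 1)
good-10k+1 {suc j} (s≤s 1≤j) = UpperBound.upper-bound j 1≤j

not-good-≤10k : ∀ {k N} → N ≤ 10 * k → ¬ Good (suc k) 4 N
not-good-≤10k {k} N≤10k good = LowerBound.no-pattern k N≤10k (good (LowerBound.colouring k))

theorem3p5 : (m : ℕ) → 3 ≤ m → IsG m 4 (10 * m ∸ 9)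
theorem3p5 (suc k) (s≤s 2≤k) = subst (IsG (suc k) 4) (sym 10[k+1]∸9≡10k+1)
  ( m≤n+m 1 (10 * k)
  , good-10k+1 2≤k
  , λ N _ N<10k+1 → not-good-≤10k (≤-pred (subst (suc N ≤_) (+-comm (10 * k) 1) N<10k+1))
  )
  where
  10[k+1]∸9≡10k+1 : 10 * suc k ∸ 9 ≡ 10 * k + 1
  10[k+1]∸9≡10k+1 = trans (cong (_∸ 9) (identity k)) (m+n∸n≡m (10 * k + 1) 9)
    where
    identity : ∀ k → 10 * suc k ≡ 10 * k + 1 + 9
    identity = solve-∀
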